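{- Let $p$ and $q$ be distinct odd primes. Let $N_{p,q}$ denote the number of solutions $(x,y,z)$ in non-negative integers of $px+qy+z=\frac{q(p-1)}{2}$, and $N_{q,p}$ the number of solutions in non-negative integers of $qx+py+z=\frac{p(q-1)}{2}$. Then the number of solutions $(x,y,z)$ in non-negative integers of $$px+qy+z=\frac{p(q-1)}{2}+\frac{q(p-1)}{2}$$ equals $2(N_{p,q}+N_{q,p})-\Big(\frac{p+1}{2}+\frac{q+1}{2}+1\Big)$. -}

module Defs where

open import Data.Nat using (ℕ; _+_; _*_; _≟_)
open import Data.List using (List; length; filter; cartesianProduct; upTo)
open import Data.Product using (_×_; _,_)

triplesUpTo : ℕ → List (ℕ × ℕ × ℕ)
triplesUpTo n = cartesianProduct (upTo (1 + n)) (cartesianProduct (upTo (1 + n)) (upTo (1 + n)))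

-- Every solution has z ≤ n, and x ≤ n, y ≤ n whenever a, b ≥ 1
-- (for the primes used here), so enumerating [0..n]³ counts all of them.
numSolutions : ℕ → ℕ → ℕ → ℕ
numSolutions a b n =
  length (filter (λ { (x , y , z) → (a * x + b * y + z) ≟ n }) (triplesUpTo n))

{-# OPTIONS --safe #-}
-- Write p = 2a + 1 and q = 2b + 1; the three right-hand sides are q a, p b and p b + q a.
-- Summing out z, numSolutions p q c counts the lattice points (x , y) with p x + q y ≤ c.
-- Cut the triangle for c = p b + q a at x = b and y = a: the box [0,b] × [0,a] lies inside it,
-- the opposite quadrant misses it, and the two remaining quadrants are, after translation,
-- the triangles for q a and p b with their left column resp. bottom row removed.
-- On the box, the point reflection (x , y) ↦ (b − x , a − y) exchanges p x + q y ≤ p b with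
-- p x + q y ≥ q a, so N_{p,q} + N_{q,p} is (a + 1)(b + 1) plus the number of box points on
-- p x + q y = q a; as p and q are distinct primes, (0 , a) is the only one.
-- Eliminating (a + 1)(b + 1) between the two counts gives the formula.
module Submission where

open import Defs
open import Data.Nat using (ℕ; zero; suc; _+_; _*_; _∸_; _/_; _%_; _≤_; _<_; _>_; NonZero; >-nonZero⁻¹; s≤s; z<s; s<s; _≟_; _≤?_)
open import Data.Nat.Properties
open import Data.Nat.DivMod using (m≡m%n+[m/n]*n; m*n/n≡m)
open import Data.Nat.Divisibility using (divides; ∣⇒≤)
open import Data.Nat.ListAction using (sum)
open import Data.Nat.ListAction.Properties using (sum-++)
open import Data.Nat.Primality using (Prime; euclidsLemma; prime⇒irreducible; ¬prime[1])
open import Data.Nat.Tactic.RingSolver using (solve-∀)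
open import Data.List using (List; []; _∷_; _++_; map; length; filter; cartesianProduct; applyUpTo)
open import Data.List.Properties using (map-++; map-∘)
open import Data.Product using (_×_; _,_)
open import Data.Sum using (inj₁; inj₂)
open import Function using (id; _∘_; _⇔_; mk⇔; Equivalence)
open import Relation.Nullary using (Dec; yes; no; ¬_; contradiction)
open import Relation.Unary using (Decidable)
open import Relation.Binary using (tri<; tri≈; tri>)
open import Relation.Binary.PropositionalEquality

m+n≡o+p⇒[m≤o⇔p≤n] : ∀ {m n o p} → m + n ≡ o + p → m ≤ o ⇔ p ≤ n
m+n≡o+p⇒[m≤o⇔p≤n] {m} {n} {o} {p} e = mk⇔
  (λ m≤o → +-cancelˡ-≤ o p n (subst (_≤ o + n) e (+-monoˡ-≤ n m≤o)))
  (λ p≤n → +-cancelʳ-≤ n m o (subst (_≤ o + n) (sym e) (+-monoʳ-≤ o p≤n)))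

𝟙 : {P : Set} → Dec P → ℕ
𝟙 (yes _) = 1
𝟙 (no _)  = 0

𝟙-yes : {P : Set} → P → (P? : Dec P) → 𝟙 P? ≡ 1
𝟙-yes _ (yes _) = refl
𝟙-yes p (no ¬p) = contradiction p ¬p

𝟙-no : {P : Set} → ¬ P → (P? : Dec P) → 𝟙 P? ≡ 0
𝟙-no ¬p (yes p) = contradiction p ¬p
𝟙-no ¬p (no _)  = refl

𝟙-cong : {P Q : Set} → P ⇔ Q → (P? : Dec P) (Q? : Dec Q) → 𝟙 P? ≡ 𝟙 Q?
𝟙-cong P⇔Q (yes p) Q? = sym (𝟙-yes (Equivalence.to P⇔Q p) Q?)
𝟙-cong P⇔Q (no ¬p) Q? = sym (𝟙-no (¬p ∘ Equivalence.from P⇔Q) Q?)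

𝟙-≤?-> : ∀ m n → m > n → 𝟙 (m ≤? n) ≡ 0
𝟙-≤?-> m n m>n = 𝟙-no (<⇒≱ m>n) (m ≤? n)

𝟙-≤?+𝟙-≥? : ∀ m n → 𝟙 (m ≤? n) + 𝟙 (n ≤? m) ≡ 1 + 𝟙 (m ≟ n)
𝟙-≤?+𝟙-≥? m n with <-cmp m n
... | tri< m<n m≢n _ =
  trans (cong₂ _+_ (𝟙-yes (<⇒≤ m<n) (m ≤? n)) (𝟙-≤?-> n m m<n)) (cong suc (sym (𝟙-no m≢n (m ≟ n))))
... | tri≈ _ refl _ =
  trans (cong₂ _+_ (𝟙-yes ≤-refl (m ≤? m)) (𝟙-yes ≤-refl (m ≤? m))) (cong suc (sym (𝟙-yes refl (m ≟ m))))
... | tri> _ m≢n n<m =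
  trans (cong₂ _+_ (𝟙-≤?-> m n n<m) (𝟙-yes (<⇒≤ n<m) (n ≤? m))) (cong suc (sym (𝟙-no m≢n (m ≟ n))))

𝟙-≤?-cancelˡ : ∀ k {m n m′ n′} → m′ ≡ k + m → n′ ≡ k + n → 𝟙 (m′ ≤? n′) ≡ 𝟙 (m ≤? n)
𝟙-≤?-cancelˡ k {m} {n} {m′} {n′} refl refl =
  𝟙-cong (mk⇔ (+-cancelˡ-≤ k m n) (+-monoʳ-≤ k)) (m′ ≤? n′) (m ≤? n)

∑ : ℕ → (ℕ → ℕ) → ℕ
∑ zero    f = 0
∑ (suc n) f = f 0 + ∑ n (f ∘ suc)

syntax ∑ n (λ i → e) = ∑[ i < n ] e

∑-cong : ∀ n {f g : ℕ → ℕ} → (∀ {i} → i < n → f i ≡ g i) → ∑ n f ≡ ∑ n g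
∑-cong zero    f≗g = refl
∑-cong (suc n) f≗g = cong₂ _+_ (f≗g z<s) (∑-cong n (f≗g ∘ s<s))

∑∑-cong : ∀ m n {f g : ℕ → ℕ → ℕ} → (∀ {i j} → i < m → j < n → f i j ≡ g i j) →
          ∑[ i < m ] ∑[ j < n ] f i j ≡ ∑[ i < m ] ∑[ j < n ] g i j
∑∑-cong m n f≗g = ∑-cong m (λ i<m → ∑-cong n (f≗g i<m))

∑-zero : ∀ n {f : ℕ → ℕ} → (∀ {i} → i < n → f i ≡ 0) → ∑ n f ≡ 0
∑-zero zero    f≗0 = refl
∑-zero (suc n) f≗0 = cong₂ _+_ (f≗0 z<s) (∑-zero n (f≗0 ∘ s<s))

∑-const : ∀ n c → ∑[ _ < n ] c ≡ n * c
∑-const zero    c = refl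
∑-const (suc n) c = cong (c +_) (∑-const n c)

∑-1 : ∀ n → ∑[ _ < n ] 1 ≡ n
∑-1 n = trans (∑-const n 1) (*-identityʳ n)

∑-distrib-+ : ∀ n (f g : ℕ → ℕ) → ∑[ i < n ] (f i + g i) ≡ ∑ n f + ∑ n g
∑-distrib-+ zero    f g = refl
∑-distrib-+ (suc n) f g = begin
  (f 0 + g 0) + ∑[ i < n ] (f (suc i) + g (suc i)) ≡⟨ cong ((f 0 + g 0) +_) (∑-distrib-+ n (f ∘ suc) (g ∘ suc)) ⟩
  (f 0 + g 0) + (∑ n (f ∘ suc) + ∑ n (g ∘ suc))     ≡⟨ +-assoc-swap (f 0) (g 0) _ _ ⟩
  (f 0 + ∑ n (f ∘ suc)) + (g 0 + ∑ n (g ∘ suc))     ∎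
  where
  open ≡-Reasoning
  +-assoc-swap : ∀ a b c d → (a + b) + (c + d) ≡ (a + c) + (b + d)
  +-assoc-swap = solve-∀

∑∑-distrib-+ : ∀ m n (f g : ℕ → ℕ → ℕ) →
  ∑[ i < m ] ∑[ j < n ] (f i j + g i j) ≡ ∑[ i < m ] ∑[ j < n ] f i j + ∑[ i < m ] ∑[ j < n ] g i j
∑∑-distrib-+ m n f g = trans (∑-cong m (λ {i} _ → ∑-distrib-+ n (f i) (g i))) (∑-distrib-+ m _ _)

∑∑-1 : ∀ m n → ∑[ _ < m ] ∑[ _ < n ] 1 ≡ m * n
∑∑-1 m n = trans (∑-cong m (λ _ → ∑-1 n)) (∑-const m n)

∑-+ : ∀ m n (f : ℕ → ℕ) → ∑ (m + n) f ≡ ∑ m f + ∑[ i < n ] f (m + i)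
∑-+ zero    n f = refl
∑-+ (suc m) n f = trans (cong (f 0 +_) (∑-+ m n (f ∘ suc))) (sym (+-assoc (f 0) _ _))

∑∑-quadrants : ∀ m₁ m₂ n₁ n₂ (f : ℕ → ℕ → ℕ) →
  ∑[ x < m₁ + m₂ ] ∑[ y < n₁ + n₂ ] f x y
  ≡ (∑[ x < m₁ ] ∑[ y < n₁ ] f x y + ∑[ x < m₂ ] ∑[ y < n₁ ] f (m₁ + x) y)
  + (∑[ x < m₁ ] ∑[ y < n₂ ] f x (n₁ + y) + ∑[ x < m₂ ] ∑[ y < n₂ ] f (m₁ + x) (n₁ + y))
∑∑-quadrants m₁ m₂ n₁ n₂ f = begin
  ∑[ x < m₁ + m₂ ] ∑[ y < n₁ + n₂ ] f x y
    ≡⟨ ∑-cong (m₁ + m₂) (λ {x} _ → ∑-+ n₁ n₂ (f x)) ⟩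
  ∑[ x < m₁ + m₂ ] (∑[ y < n₁ ] f x y + ∑[ y < n₂ ] f x (n₁ + y))
    ≡⟨ ∑-distrib-+ (m₁ + m₂) _ _ ⟩
  ∑[ x < m₁ + m₂ ] ∑[ y < n₁ ] f x y + ∑[ x < m₁ + m₂ ] ∑[ y < n₂ ] f x (n₁ + y)
    ≡⟨ cong₂ _+_ (∑-+ m₁ m₂ _) (∑-+ m₁ m₂ _) ⟩
  (∑[ x < m₁ ] ∑[ y < n₁ ] f x y + ∑[ x < m₂ ] ∑[ y < n₁ ] f (m₁ + x) y)
  + (∑[ x < m₁ ] ∑[ y < n₂ ] f x (n₁ + y) + ∑[ x < m₂ ] ∑[ y < n₂ ] f (m₁ + x) (n₁ + y)) ∎
  where open ≡-Reasoning

∑-suc : ∀ n (f : ℕ → ℕ) → ∑ (suc n) f ≡ ∑ n f + f n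
∑-suc zero    f = +-identityʳ (f 0)
∑-suc (suc n) f = trans (cong (f 0 +_) (∑-suc n (f ∘ suc))) (sym (+-assoc (f 0) _ _))

∑-reverse : ∀ n (f : ℕ → ℕ) → ∑ (suc n) f ≡ ∑[ i < suc n ] f (n ∸ i)
∑-reverse zero    f = refl
∑-reverse (suc n) f = begin
  ∑ (suc (suc n)) f                    ≡⟨ ∑-suc (suc n) f ⟩
  ∑ (suc n) f + f (suc n)              ≡⟨ +-comm (∑ (suc n) f) _ ⟩
  f (suc n) + ∑ (suc n) f              ≡⟨ cong (f (suc n) +_) (∑-reverse n f) ⟩
  f (suc n) + ∑[ i < suc n ] f (n ∸ i) ∎
  where open ≡-Reasoning

∑-comm : ∀ m n (f : ℕ → ℕ → ℕ) → ∑[ i < m ] ∑[ j < n ] f i j ≡ ∑[ j < n ] ∑[ i < m ] f i j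
∑-comm zero    n f = sym (∑-zero n (λ _ → refl))
∑-comm (suc m) n f = trans (cong (∑ n (f 0) +_) (∑-comm m n (f ∘ suc))) (sym (∑-distrib-+ n (f 0) _))

∑-extend : ∀ {m n} {f : ℕ → ℕ} → m ≤ n → (∀ {i} → m ≤ i → f i ≡ 0) → ∑ n f ≡ ∑ m f
∑-extend {m} {n} {f} m≤n m≤⇒0 = begin
  ∑ n f                            ≡⟨ cong (λ k → ∑ k f) (m+[n∸m]≡n m≤n) ⟨
  ∑ (m + (n ∸ m)) f                ≡⟨ ∑-+ m (n ∸ m) f ⟩
  ∑ m f + ∑[ i < n ∸ m ] f (m + i) ≡⟨ cong (∑ m f +_) (∑-zero (n ∸ m) (λ _ → m≤⇒0 (m≤m+n m _))) ⟩
  ∑ m f + 0                        ≡⟨ +-identityʳ _ ⟩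
  ∑ m f                            ∎
  where open ≡-Reasoning

∑-truncate : ∀ m n {f : ℕ → ℕ} → (∀ {i} → m ≤ i → f i ≡ 0) → (∀ {i} → n ≤ i → f i ≡ 0) → ∑ n f ≡ ∑ m f
∑-truncate m n m≤⇒0 n≤⇒0 with ≤-total m n
... | inj₁ m≤n = ∑-extend m≤n m≤⇒0
... | inj₂ n≤m = sym (∑-extend n≤m n≤⇒0)

∑-indicator : ∀ n {d} → d < n → ∑[ i < n ] 𝟙 (i ≟ d) ≡ 1
∑-indicator (suc n) {zero}  _ =
  cong (1 +_) (∑-zero n (λ {i} _ → 𝟙-no (λ ()) (suc i ≟ 0)))
∑-indicator (suc n) {suc d} (s<s d<n) =
  trans (∑-cong n (λ {i} _ → 𝟙-cong (mk⇔ suc-injective (cong suc)) (suc i ≟ suc d) (i ≟ d))) (∑-indicator n d<n)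

∑-𝟙-+≟ : ∀ c n → ∑[ z < suc n ] 𝟙 (c + z ≟ n) ≡ 𝟙 (c ≤? n)
∑-𝟙-+≟ c n with c ≤? n
... | yes c≤n = trans (∑-cong (suc n) (λ {z} _ → 𝟙-cong c+z≡n⇔z≡n∸c (c + z ≟ n) (z ≟ n ∸ c)))
                      (∑-indicator (suc n) (s≤s (m∸n≤m n c)))
  where
  c+z≡n⇔z≡n∸c : ∀ {z} → c + z ≡ n ⇔ z ≡ n ∸ c
  c+z≡n⇔z≡n∸c {z} = mk⇔ (λ e → trans (sym (m+n∸m≡n c z)) (cong (_∸ c) e))
                        (λ e → trans (cong (c +_) e) (m+[n∸m]≡n c≤n))
... | no c≰n = ∑-zero (suc n) (λ {z} _ → 𝟙-no (λ e → c≰n (subst (c ≤_) e (m≤m+n c z))) (c + z ≟ n))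

length-filter : ∀ {A : Set} {P : A → Set} (P? : Decidable P) xs →
                length (filter P? xs) ≡ sum (map (𝟙 ∘ P?) xs)
length-filter P? []       = refl
length-filter P? (x ∷ xs) with P? x
... | yes _ = cong suc (length-filter P? xs)
... | no _  = length-filter P? xs

sum-map-cartesianProduct : ∀ {A B : Set} (f : A × B → ℕ) xs ys →
  sum (map f (cartesianProduct xs ys)) ≡ sum (map (λ x → sum (map (λ y → f (x , y)) ys)) xs)
sum-map-cartesianProduct f []       ys = refl
sum-map-cartesianProduct f (x ∷ xs) ys = begin
  sum (map f (map (x ,_) ys ++ cartesianProduct xs ys))
    ≡⟨ cong sum (map-++ f (map (x ,_) ys) _) ⟩
  sum (map f (map (x ,_) ys) ++ map f (cartesianProduct xs ys))
    ≡⟨ sum-++ (map f (map (x ,_) ys)) _ ⟩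
  sum (map f (map (x ,_) ys)) + sum (map f (cartesianProduct xs ys))
    ≡⟨ cong₂ _+_ (sym (cong sum (map-∘ ys))) (sum-map-cartesianProduct f xs ys) ⟩
  sum (map (λ y → f (x , y)) ys) + sum (map (λ x → sum (map (λ y → f (x , y)) ys)) xs) ∎
  where open ≡-Reasoning

sum-map-applyUpTo : ∀ (f g : ℕ → ℕ) n → sum (map f (applyUpTo g n)) ≡ ∑[ i < n ] f (g i)
sum-map-applyUpTo f g zero    = refl
sum-map-applyUpTo f g (suc n) = cong (f (g 0) +_) (sum-map-applyUpTo f (g ∘ suc) n)

length-filter-triplesUpTo : ∀ n {P : ℕ × ℕ × ℕ → Set} (P? : Decidable P) →
  length (filter P? (triplesUpTo n)) ≡ ∑[ x < suc n ] ∑[ y < suc n ] ∑[ z < suc n ] 𝟙 (P? (x , y , z))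
length-filter-triplesUpTo n P? = begin
  length (filter P? (triplesUpTo n))
    ≡⟨ length-filter P? (triplesUpTo n) ⟩
  sum (map (𝟙 ∘ P?) (triplesUpTo n))
    ≡⟨ sum-map-cartesianProduct (𝟙 ∘ P?) xs (cartesianProduct xs xs) ⟩
  sum (map (λ x → sum (map (λ w → 𝟙 (P? (x , w))) (cartesianProduct xs xs))) xs)
    ≡⟨ sum-map-applyUpTo _ id (suc n) ⟩
  ∑[ x < suc n ] sum (map (λ w → 𝟙 (P? (x , w))) (cartesianProduct xs xs))
    ≡⟨ ∑-cong (suc n) (λ {x} _ → row x) ⟩
  ∑[ x < suc n ] ∑[ y < suc n ] ∑[ z < suc n ] 𝟙 (P? (x , y , z)) ∎
  where
  open ≡-Reasoning
  xs : List ℕ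
  xs = applyUpTo id (suc n)
  row : ∀ x → sum (map (λ w → 𝟙 (P? (x , w))) (cartesianProduct xs xs))
              ≡ ∑[ y < suc n ] ∑[ z < suc n ] 𝟙 (P? (x , y , z))
  row x = trans (sum-map-cartesianProduct _ xs xs)
                (trans (sum-map-applyUpTo _ id (suc n))
                       (∑-cong (suc n) (λ {y} _ → sum-map-applyUpTo (λ z → 𝟙 (P? (x , y , z))) id (suc n))))

numSolutions≡∑∑∑ : ∀ a b n →
  numSolutions a b n ≡ ∑[ x < suc n ] ∑[ y < suc n ] ∑[ z < suc n ] 𝟙 (a * x + b * y + z ≟ n)
-- The predicate of Defs cannot be inferred here, but this copy of it is definitionally equal
-- because record-pattern lambdas are compared up to eta.
numSolutions≡∑∑∑ a b n = length-filter-triplesUpTo n (λ { (x , y , z) → a * x + b * y + z ≟ n })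

numSolutions≡∑∑ : ∀ a b n → numSolutions a b n ≡ ∑[ x < suc n ] ∑[ y < suc n ] 𝟙 (a * x + b * y ≤? n)
numSolutions≡∑∑ a b n =
  trans (numSolutions≡∑∑∑ a b n) (∑∑-cong (suc n) (suc n) (λ {x} {y} _ _ → ∑-𝟙-+≟ (a * x + b * y) n))

countBelow : (p q c m n : ℕ) → ℕ
countBelow p q c m n = ∑[ x < m ] ∑[ y < n ] 𝟙 (p * x + q * y ≤? c)

numSolutions≡countBelow : ∀ p q c m n → c < p * m → c < q * n → numSolutions p q c ≡ countBelow p q c m n
numSolutions≡countBelow p@(suc _) q@(suc _) c m n c<p*m c<q*n = begin
  numSolutions p q c
    ≡⟨ numSolutions≡∑∑ p q c ⟩
  ∑[ x < suc c ] ∑[ y < suc c ] 𝟙 (p * x + q * y ≤? c)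
    ≡⟨ ∑-cong (suc c) (λ {x} _ → ∑-truncate n (suc c)
         (λ {y} n≤y → y-far x y (<-≤-trans c<q*n (*-monoʳ-≤ q n≤y)))
         (λ {y} c<y → y-far x y (<-≤-trans c<y (m≤n*m y q)))) ⟩
  ∑[ x < suc c ] ∑[ y < n ] 𝟙 (p * x + q * y ≤? c)
    ≡⟨ ∑-truncate m (suc c)
         (λ {x} m≤x → ∑-zero n (λ {y} _ → x-far x y (<-≤-trans c<p*m (*-monoʳ-≤ p m≤x))))
         (λ {x} c<x → ∑-zero n (λ {y} _ → x-far x y (<-≤-trans c<x (m≤n*m x p)))) ⟩
  countBelow p q c m n ∎
  where
  open ≡-Reasoning
  x-far : ∀ x y → c < p * x → 𝟙 (p * x + q * y ≤? c) ≡ 0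
  x-far x y c<px = 𝟙-≤?-> (p * x + q * y) c (<-≤-trans c<px (m≤m+n (p * x) (q * y)))
  y-far : ∀ x y → c < q * y → 𝟙 (p * x + q * y ≤? c) ≡ 0
  y-far x y c<qy = 𝟙-≤?-> (p * x + q * y) c (<-≤-trans c<qy (m≤n+m (q * y) (p * x)))

countBelow-swap : ∀ p q c m n → countBelow q p c n m ≡ countBelow p q c m n
countBelow-swap p q c m n =
  trans (∑-comm n m _)
        (∑∑-cong m n (λ {x} {y} _ _ → 𝟙-cong (mk⇔ (subst (_≤ c) (+-comm (q * y) (p * x)))
                                                  (subst (_≤ c) (+-comm (p * x) (q * y))))
                                             (q * y + p * x ≤? c) (p * x + q * y ≤? c)))

countBelow-split : ∀ p q a b .{{_ : NonZero p}} →
  countBelow p q (p * b + q * a) (suc b + b) (suc a + a) + (suc a + suc b)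
  ≡ suc b * suc a + (countBelow p q (q * a) (suc b) (suc a) + countBelow p q (p * b) (suc b) (suc a))
countBelow-split p q a b = begin
  countBelow p q c (suc b + b) (suc a + a) + (suc a + suc b)
    ≡⟨ cong (_+ (suc a + suc b)) (∑∑-quadrants (suc b) b (suc a) a F) ⟩
  (Q₁ + Q₂) + (Q₃ + Q₄) + (suc a + suc b)
    ≡⟨ cong₂ (λ i j → (i + Q₂) + (Q₃ + j) + (suc a + suc b)) Q₁≡[1+b]*[1+a] Q₄≡0 ⟩
  (suc b * suc a + Q₂) + (Q₃ + 0) + (suc a + suc b)
    ≡⟨ regroup (suc b * suc a) Q₂ Q₃ (suc a) (suc b) ⟩
  suc b * suc a + ((suc a + Q₂) + (suc b + Q₃))
    ≡⟨ cong (λ i → suc b * suc a + i) (cong₂ _+_ column₀-split row₀-split) ⟨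
  suc b * suc a + (countBelow p q (q * a) (suc b) (suc a) + countBelow p q (p * b) (suc b) (suc a)) ∎
  where
  open ≡-Reasoning
  c : ℕ
  c = p * b + q * a
  F : ℕ → ℕ → ℕ
  F x y = 𝟙 (p * x + q * y ≤? c)
  Q₁ Q₂ Q₃ Q₄ : ℕ
  Q₁ = ∑[ x < suc b ] ∑[ y < suc a ] F x y
  Q₂ = ∑[ x < b ] ∑[ y < suc a ] F (suc b + x) y
  Q₃ = ∑[ x < suc b ] ∑[ y < a ] F x (suc a + y)
  Q₄ = ∑[ x < b ] ∑[ y < a ] F (suc b + x) (suc a + y)
  regroup : ∀ k i j m n → (k + i) + (j + 0) + (m + n) ≡ k + ((m + i) + (n + j))
  regroup = solve-∀

  Q₁≡[1+b]*[1+a] : Q₁ ≡ suc b * suc a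
  Q₁≡[1+b]*[1+a] = trans (∑∑-cong (suc b) (suc a) (λ {x} {y} x<1+b y<1+a →
                     𝟙-yes (+-mono-≤ (*-monoʳ-≤ p (≤-pred x<1+b)) (*-monoʳ-≤ q (≤-pred y<1+a)))
                           (p * x + q * y ≤? c)))
                   (∑∑-1 (suc b) (suc a))

  Q₄≡0 : Q₄ ≡ 0
  Q₄≡0 = ∑-zero b (λ {x} _ → ∑-zero a (λ {y} _ →
    𝟙-≤?-> (p * (suc b + x) + q * (suc a + y)) c
      (subst (c <_) (sym (corner p q a b x y)) (m<m+n c (<-≤-trans (>-nonZero⁻¹ p) (m≤m+n p _))))))
    where
    corner : ∀ p q a b x y → p * (suc b + x) + q * (suc a + y) ≡ (p * b + q * a) + (p + (p * x + q * suc y))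
    corner = solve-∀

  column₀-split : countBelow p q (q * a) (suc b) (suc a) ≡ suc a + Q₂
  column₀-split = cong₂ _+_
    (trans (∑-cong (suc a) (λ {y} y<1+a →
             𝟙-yes (subst (_≤ q * a) (cong (_+ q * y) (sym (*-zeroʳ p))) (*-monoʳ-≤ q (≤-pred y<1+a)))
                   (p * 0 + q * y ≤? q * a)))
           (∑-1 (suc a)))
    (sym (∑∑-cong b (suc a) (λ {x} {y} _ _ → 𝟙-≤?-cancelˡ (p * b) {n = q * a} (shift p q b x y) refl)))
    where
    shift : ∀ p q b x y → p * (suc b + x) + q * y ≡ p * b + (p * suc x + q * y)
    shift = solve-∀

  row₀-split : countBelow p q (p * b) (suc b) (suc a) ≡ suc b + Q₃
  row₀-split = trans
    (∑-distrib-+ (suc b) (λ x → 𝟙 (p * x + q * 0 ≤? p * b)) (λ x → ∑[ y < a ] 𝟙 (p * x + q * suc y ≤? p * b)))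
    (cong₂ _+_
    (trans (∑-cong (suc b) (λ {x} x<1+b →
             𝟙-yes (subst (_≤ p * b) (sym (trans (cong (p * x +_) (*-zeroʳ q)) (+-identityʳ _)))
                          (*-monoʳ-≤ p (≤-pred x<1+b)))
                   (p * x + q * 0 ≤? p * b)))
           (∑-1 (suc b)))
    (sym (∑∑-cong (suc b) a (λ {x} {y} _ _ →
      𝟙-≤?-cancelˡ (q * a) (shift p q a x y) (+-comm (p * b) (q * a))))))
    where
    shift : ∀ p q a x y → p * x + q * (suc a + y) ≡ q * a + (p * x + q * suc y)
    shift = solve-∀

countBelow-complement : ∀ p q a b →
  countBelow p q (q * a) (suc b) (suc a) + countBelow p q (p * b) (suc b) (suc a)
  ≡ suc b * suc a + ∑[ x < suc b ] ∑[ y < suc a ] 𝟙 (p * x + q * y ≟ q * a)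
countBelow-complement p q a b = begin
  ∑∑ H + ∑∑ G
    ≡⟨ cong (∑∑ H +_) reflect ⟩
  ∑∑ H + ∑∑ (λ x y → G (b ∸ x) (a ∸ y))
    ≡⟨ ∑∑-distrib-+ (suc b) (suc a) H (λ x y → G (b ∸ x) (a ∸ y)) ⟨
  ∑∑ (λ x y → H x y + G (b ∸ x) (a ∸ y))
    ≡⟨ ∑∑-cong (suc b) (suc a) (λ x<1+b y<1+a → H+G∘reflect≡1+E (≤-pred x<1+b) (≤-pred y<1+a)) ⟩
  ∑∑ (λ x y → 1 + E x y)
    ≡⟨ ∑∑-distrib-+ (suc b) (suc a) (λ _ _ → 1) E ⟩
  ∑∑ (λ _ _ → 1) + ∑∑ E
    ≡⟨ cong (_+ ∑∑ E) (∑∑-1 (suc b) (suc a)) ⟩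
  suc b * suc a + ∑∑ E ∎
  where
  open ≡-Reasoning
  ∑∑ : (ℕ → ℕ → ℕ) → ℕ
  ∑∑ f = ∑[ x < suc b ] ∑[ y < suc a ] f x y
  H G E : ℕ → ℕ → ℕ
  H x y = 𝟙 (p * x + q * y ≤? q * a)
  G x y = 𝟙 (p * x + q * y ≤? p * b)
  E x y = 𝟙 (p * x + q * y ≟ q * a)
  reflect : ∑∑ G ≡ ∑∑ (λ x y → G (b ∸ x) (a ∸ y))
  reflect = trans (∑-reverse b (λ x → ∑[ y < suc a ] G x y))
                  (∑-cong (suc b) (λ {x} _ → ∑-reverse a (G (b ∸ x))))
  reflected+original : ∀ {x y} → x ≤ b → y ≤ a →
    (p * (b ∸ x) + q * (a ∸ y)) + (p * x + q * y) ≡ p * b + q * a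
  reflected+original {x} {y} x≤b y≤a = begin
    (p * (b ∸ x) + q * (a ∸ y)) + (p * x + q * y)   ≡⟨ +-assoc-swap (p * (b ∸ x)) _ _ _ ⟩
    (p * (b ∸ x) + p * x) + (q * (a ∸ y) + q * y)   ≡⟨ cong₂ _+_ (*-distribˡ-+ p (b ∸ x) x) (*-distribˡ-+ q (a ∸ y) y) ⟨
    p * (b ∸ x + x) + q * (a ∸ y + y)               ≡⟨ cong₂ (λ i j → p * i + q * j) (m∸n+n≡m x≤b) (m∸n+n≡m y≤a) ⟩
    p * b + q * a                                   ∎
    where
    +-assoc-swap : ∀ i j k l → (i + j) + (k + l) ≡ (i + k) + (j + l)
    +-assoc-swap = solve-∀
  H+G∘reflect≡1+E : ∀ {x y} → x ≤ b → y ≤ a → H x y + G (b ∸ x) (a ∸ y) ≡ 1 + E x y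
  H+G∘reflect≡1+E {x} {y} x≤b y≤a = begin
    H x y + G (b ∸ x) (a ∸ y)
      ≡⟨ cong (H x y +_) (𝟙-cong (m+n≡o+p⇒[m≤o⇔p≤n] (reflected+original x≤b y≤a)) _ (q * a ≤? u)) ⟩
    𝟙 (u ≤? q * a) + 𝟙 (q * a ≤? u)
      ≡⟨ 𝟙-≤?+𝟙-≥? u (q * a) ⟩
    1 + E x y ∎
    where
    u : ℕ
    u = p * x + q * y

∑∑-onLine≡1 : ∀ p q a b .{{_ : NonZero q}} → (∀ {x y} → p * x + q * y ≡ q * a → x ≤ b → x ≡ 0) →
  ∑[ x < suc b ] ∑[ y < suc a ] 𝟙 (p * x + q * y ≟ q * a) ≡ 1
∑∑-onLine≡1 p q a b onLine⇒x≡0 = cong₂ _+_ column₀ other-columns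
  where
  onColumn₀⇔ : ∀ {y} → p * 0 + q * y ≡ q * a ⇔ y ≡ a
  onColumn₀⇔ {y} = mk⇔ (λ e → *-cancelˡ-≡ y a q (trans (cong (_+ q * y) (sym (*-zeroʳ p))) e))
                       (λ { refl → cong (_+ q * y) (*-zeroʳ p) })
  column₀ : ∑[ y < suc a ] 𝟙 (p * 0 + q * y ≟ q * a) ≡ 1
  column₀ = trans (∑-cong (suc a) (λ {y} _ → 𝟙-cong onColumn₀⇔ (p * 0 + q * y ≟ q * a) (y ≟ a)))
                  (∑-indicator (suc a) ≤-refl)
  other-columns : ∑[ x < b ] ∑[ y < suc a ] 𝟙 (p * suc x + q * y ≟ q * a) ≡ 0
  other-columns = ∑-zero b (λ {x} x<b → ∑-zero (suc a) (λ {y} _ →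
    𝟙-no (λ e → 1+n≢0 (onLine⇒x≡0 e x<b)) (p * suc x + q * y ≟ q * a)))

distinctPrimes-onLine⇒x≡0 : ∀ {p q x y a} → Prime p → Prime q → p ≢ q →
                            p * x + q * y ≡ q * a → x < q → x ≡ 0
distinctPrimes-onLine⇒x≡0 {p} {q} {x} {y} {a} p-prime q-prime p≢q e x<q
  with euclidsLemma p x q-prime (divides (a ∸ y) p*x≡[a∸y]*q)
  where
  p*x≡[a∸y]*q : p * x ≡ (a ∸ y) * q
  p*x≡[a∸y]*q = begin
    p * x                 ≡⟨ m+n∸n≡m (p * x) (q * y) ⟨
    p * x + q * y ∸ q * y ≡⟨ cong (_∸ q * y) e ⟩
    q * a ∸ q * y         ≡⟨ *-distribˡ-∸ q a y ⟨
    q * (a ∸ y)           ≡⟨ *-comm q (a ∸ y) ⟩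
    (a ∸ y) * q           ∎
    where open ≡-Reasoning
... | inj₁ q∣p with prime⇒irreducible p-prime q∣p
...   | inj₁ q≡1 = contradiction (subst Prime q≡1 q-prime) ¬prime[1]
...   | inj₂ q≡p = contradiction (sym q≡p) p≢q
distinctPrimes-onLine⇒x≡0 {x = zero}  _ _ _ _ _ | inj₂ _ = refl
distinctPrimes-onLine⇒x≡0 {x = suc _} _ _ _ _ x<q | inj₂ q∣x = contradiction (∣⇒≤ q∣x) (<⇒≱ x<q)

countBelow-identity : ∀ p q a b .{{_ : NonZero p}} .{{_ : NonZero q}} →
  (∀ {x y} → p * x + q * y ≡ q * a → x ≤ b → x ≡ 0) →
  countBelow p q (p * b + q * a) (suc b + b) (suc a + a) + (suc a + suc b + 1)
  ≡ 2 * (countBelow p q (q * a) (suc b) (suc a) + countBelow p q (p * b) (suc b) (suc a))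
countBelow-identity p q a b onLine⇒x≡0 = begin
  N + (suc a + suc b + 1)           ≡⟨ +-assoc N (suc a + suc b) 1 ⟨
  N + (suc a + suc b) + 1           ≡⟨ cong (_+ 1) (countBelow-split p q a b) ⟩
  suc b * suc a + (X + Y) + 1       ≡⟨ swap-+1 (suc b * suc a) (X + Y) ⟩
  (X + Y) + (suc b * suc a + 1)     ≡⟨ cong ((X + Y) +_) [1+b]*[1+a]+1≡X+Y ⟩
  (X + Y) + (X + Y)                 ≡⟨ m+m≡2*m (X + Y) ⟩
  2 * (X + Y)                       ∎
  where
  open ≡-Reasoning
  N X Y : ℕ
  N = countBelow p q (p * b + q * a) (suc b + b) (suc a + a)
  X = countBelow p q (q * a) (suc b) (suc a)
  Y = countBelow p q (p * b) (suc b) (suc a)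
  swap-+1 : ∀ k s → k + s + 1 ≡ s + (k + 1)
  swap-+1 = solve-∀
  m+m≡2*m : ∀ m → m + m ≡ 2 * m
  m+m≡2*m = solve-∀
  [1+b]*[1+a]+1≡X+Y : suc b * suc a + 1 ≡ X + Y
  [1+b]*[1+a]+1≡X+Y =
    sym (trans (countBelow-complement p q a b) (cong (suc b * suc a +_) (∑∑-onLine≡1 p q a b onLine⇒x≡0)))

numSolutions-identity : ∀ {p q a b} → p ≡ suc (a * 2) → q ≡ suc (b * 2) → Prime p → Prime q → p ≢ q →
  numSolutions p q (p * b + q * a) + (suc a + suc b + 1)
  ≡ 2 * (numSolutions p q (q * a) + numSolutions q p (p * b))
numSolutions-identity {p} {q} {a} {b} refl refl p-prime q-prime p≢q = begin
  numSolutions p q (p * b + q * a) + (suc a + suc b + 1)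
    ≡⟨ cong (_+ (suc a + suc b + 1)) N≡ ⟩
  countBelow p q (p * b + q * a) (suc b + b) (suc a + a) + (suc a + suc b + 1)
    ≡⟨ countBelow-identity p q a b (λ e x≤b → distinctPrimes-onLine⇒x≡0 p-prime q-prime p≢q e (x≤b⇒x<q x≤b)) ⟩
  2 * (countBelow p q (q * a) (suc b) (suc a) + countBelow p q (p * b) (suc b) (suc a))
    ≡⟨ cong (2 *_) (cong₂ _+_ X≡ Y≡) ⟨
  2 * (numSolutions p q (q * a) + numSolutions q p (p * b)) ∎
  where
  open ≡-Reasoning
  x≤b⇒x<q : ∀ {x} → x ≤ b → x < q
  x≤b⇒x<q x≤b = s≤s (≤-trans x≤b (m≤m*n b 2))
  <-by : ∀ {m n} k → m + suc k ≡ n → m < n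
  <-by {m} k e = subst (m <_) e (m<m+n m z<s)
  gap₁ : ∀ a b → suc (b * 2) * a + suc (a + b) ≡ suc (a * 2) * suc b
  gap₁ = solve-∀
  gap₂ : ∀ a b → suc (a * 2) * b + suc (a + b) ≡ suc (b * 2) * suc a
  gap₂ = solve-∀
  gap₃ : ∀ a b → suc (a * 2) * b + suc (b * 2) * a + suc (a + b) ≡ suc (a * 2) * (suc b + b)
  gap₃ = solve-∀
  gap₄ : ∀ a b → suc (a * 2) * b + suc (b * 2) * a + suc (a + b) ≡ suc (b * 2) * (suc a + a)
  gap₄ = solve-∀
  N≡ : numSolutions p q (p * b + q * a) ≡ countBelow p q (p * b + q * a) (suc b + b) (suc a + a)
  N≡ = numSolutions≡countBelow p q _ (suc b + b) (suc a + a) (<-by (a + b) (gap₃ a b)) (<-by (a + b) (gap₄ a b))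
  X≡ : numSolutions p q (q * a) ≡ countBelow p q (q * a) (suc b) (suc a)
  X≡ = numSolutions≡countBelow p q (q * a) (suc b) (suc a) (<-by (a + b) (gap₁ a b)) (*-monoʳ-< q (n<1+n a))
  Y≡ : numSolutions q p (p * b) ≡ countBelow p q (p * b) (suc b) (suc a)
  Y≡ = trans (numSolutions≡countBelow q p (p * b) (suc a) (suc b) (<-by (a + b) (gap₂ a b)) (*-monoʳ-< p (n<1+n b)))
             (countBelow-swap p q (p * b) (suc b) (suc a))

odd⇒≡1+[n/2]*2 : ∀ n → n % 2 ≡ 1 → n ≡ suc (n / 2 * 2)
odd⇒≡1+[n/2]*2 n n-odd = trans (m≡m%n+[m/n]*n n 2) (cong (_+ n / 2 * 2) n-odd)

odd⇒m*[n∸1]/2≡m*[n/2] : ∀ m n → n % 2 ≡ 1 → m * (n ∸ 1) / 2 ≡ m * (n / 2)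
odd⇒m*[n∸1]/2≡m*[n/2] m n n-odd = begin
  m * (n ∸ 1) / 2        ≡⟨ cong (λ i → m * (i ∸ 1) / 2) (odd⇒≡1+[n/2]*2 n n-odd) ⟩
  m * (n / 2 * 2) / 2    ≡⟨ cong (_/ 2) (*-assoc m (n / 2) 2) ⟨
  m * (n / 2) * 2 / 2    ≡⟨ m*n/n≡m (m * (n / 2)) 2 ⟩
  m * (n / 2)            ∎
  where open ≡-Reasoning

odd⇒[n+1]/2≡1+n/2 : ∀ n → n % 2 ≡ 1 → (n + 1) / 2 ≡ suc (n / 2)
odd⇒[n+1]/2≡1+n/2 n n-odd = begin
  (n + 1) / 2                ≡⟨ cong (λ i → (i + 1) / 2) (odd⇒≡1+[n/2]*2 n n-odd) ⟩
  (suc (n / 2 * 2) + 1) / 2  ≡⟨ cong (_/ 2) (double+2 (n / 2)) ⟩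
  suc (n / 2) * 2 / 2        ≡⟨ m*n/n≡m (suc (n / 2)) 2 ⟩
  suc (n / 2)                ∎
  where
  open ≡-Reasoning
  double+2 : ∀ k → suc (k * 2) + 1 ≡ suc k * 2
  double+2 = solve-∀

open import Data.Integer using (+_; _-_; _⊖_)
open import Data.Integer.Properties using ([+m]-[+n]≡m⊖n; ⊖-≥)

m+n≡o⇒+m≡+o-+n : ∀ {m n o} → m + n ≡ o → + m ≡ + o - + n
m+n≡o⇒+m≡+o-+n {m} {n} refl = sym (begin
  + (m + n) - + n  ≡⟨ [+m]-[+n]≡m⊖n (m + n) n ⟩
  (m + n) ⊖ n      ≡⟨ ⊖-≥ (m≤n+m n m) ⟩
  + (m + n ∸ n)    ≡⟨ cong +_ (m+n∸n≡m m n) ⟩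
  + m              ∎)
  where open ≡-Reasoning

lemma9 : (p q : ℕ) → Prime p → Prime q → p % 2 ≡ 1 → q % 2 ≡ 1 → p ≢ q →
           let Npq = numSolutions p q ((q * (p ∸ 1)) / 2)
               Nqp = numSolutions q p ((p * (q ∸ 1)) / 2)
           in + numSolutions p q ((p * (q ∸ 1)) / 2 + (q * (p ∸ 1)) / 2)
              ≡ + (2 * (Npq + Nqp)) - + ((p + 1) / 2 + (q + 1) / 2 + 1)
lemma9 p q p-prime q-prime p-odd q-odd p≢q = begin
  + numSolutions p q (p * (q ∸ 1) / 2 + q * (p ∸ 1) / 2)
    ≡⟨ cong (λ c → + numSolutions p q c) (cong₂ _+_ p*b≡ q*a≡) ⟩
  + numSolutions p q (p * b + q * a)
    ≡⟨ m+n≡o⇒+m≡+o-+n (numSolutions-identity (odd⇒≡1+[n/2]*2 p p-odd) (odd⇒≡1+[n/2]*2 q q-odd) p-prime q-prime p≢q) ⟩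
  + (2 * (numSolutions p q (q * a) + numSolutions q p (p * b))) - + (suc a + suc b + 1)
    ≡⟨ cong₂ (λ i j → + (2 * i) - + j)
             (cong₂ _+_ (cong (numSolutions p q) (sym q*a≡)) (cong (numSolutions q p) (sym p*b≡)))
             (cong₂ (λ i j → i + j + 1) (sym (odd⇒[n+1]/2≡1+n/2 p p-odd)) (sym (odd⇒[n+1]/2≡1+n/2 q q-odd))) ⟩
  + (2 * (numSolutions p q (q * (p ∸ 1) / 2) + numSolutions q p (p * (q ∸ 1) / 2)))
    - + ((p + 1) / 2 + (q + 1) / 2 + 1) ∎
  where
  open ≡-Reasoning
  a b : ℕ
  a = p / 2
  b = q / 2
  p*b≡ : p * (q ∸ 1) / 2 ≡ p * b
  p*b≡ = odd⇒m*[n∸1]/2≡m*[n/2] p q q-odd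
  q*a≡ : q * (p ∸ 1) / 2 ≡ q * a
  q*a≡ = odd⇒m*[n∸1]/2≡m*[n/2] q p p-odd
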